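{- Let $\mu',\nu'>0$ be rational. The following are equivalent: (M1') the lattice $\Lambda_{\mu',\nu'}=\{(m\mu',n\nu'):m,n\in\mathbb{Z}\}$ is disjoint from $\mathcal{D}\cup\mathcal{D}'$; (M2') there exist integers $m\ge 0$, $n\ge 1$ such that $\frac{m}{\mu'}+\frac{n}{\nu'}=1$.
   Context: $\mathcal{D}:=\bigcup_{n\in\mathbb{Z}}\{(x,y): n<x<n+1,\ n<y<n+1\}$ and $\mathcal{D}':=\bigcup_{n\in\mathbb{Z}}\{(x,y): n\le x\le n+1,\ n<y<n+1,\ x\ne y\}$, subsets of $\mathbb{R}^2$. -}

module Defs where

open import Data.Integer as ℤ using (ℤ; +_)
open import Data.Nat as ℕ using (ℕ)
open import Data.Rational using (ℚ; _<_; _≤_; _+_; _*_; _÷_; Positive; 1ℚ; _/_)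
open import Data.Rational.Properties using (pos⇒nonZero)
open import Data.Product using (_×_; ∃-syntax)
open import Relation.Binary.PropositionalEquality using (_≡_; _≢_)
open import Relation.Nullary using (¬_)

⟦_⟧ : ℤ → ℚ
⟦ k ⟧ = k / 1

_∈𝒟 : ℚ × ℚ → Set
_∈𝒟 (x Data.Product., y) = ∃[ k ] (⟦ k ⟧ < x × x < ⟦ k ⟧ + 1ℚ × ⟦ k ⟧ < y × y < ⟦ k ⟧ + 1ℚ)

_∈𝒟' : ℚ × ℚ → Set
_∈𝒟' (x Data.Product., y) =
  ∃[ k ] (⟦ k ⟧ ≤ x × x ≤ ⟦ k ⟧ + 1ℚ × ⟦ k ⟧ < y × y < ⟦ k ⟧ + 1ℚ × x ≢ y)

latticePt : ℚ → ℚ → ℤ → ℤ → ℚ × ℚ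
latticePt μ ν m n = (⟦ m ⟧ * μ) Data.Product., (⟦ n ⟧ * ν)

M1' : ℚ → ℚ → Set
M1' μ ν = ∀ (m n : ℤ) → ¬ (latticePt μ ν m n ∈𝒟) × ¬ (latticePt μ ν m n ∈𝒟')

M2' : (μ ν : ℚ) → .{{Positive μ}} → .{{Positive ν}} → Set
M2' μ ν = ∃[ m ] ∃[ n ] (1 ℕ.≤ n ×
  (((+ m) / 1) ÷ μ) {{pos⇒nonZero μ}} + (((+ n) / 1) ÷ ν) {{pos⇒nonZero ν}} ≡ 1ℚ)

module Submission where

-- (M2') ⇒ (M1'): the weights A = p/μ ≥ 0 and B = q/ν > 0 sum to 1 and send a lattice point
-- (x , y) = (m μ , n ν) to the integer A x + B y = p m + q n.  For a point of a cell
-- k ≤ x ≤ k + 1, k < y < k + 1 this weighted mean lies strictly between k and k + 1: impossible.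
--
-- (M1') ⇒ (M2'): write μ / ν = a / b in lowest terms, so b μ = a ν.  The diagonal lattice point
-- (b μ , a ν) avoids 𝒟, hence b μ = a ν = N is a positive integer.  Bézout gives n₀ b = 1 + m₀ a;
-- the point (m₀ μ , n₀ ν) lies above the diagonal and avoids 𝒟', so an integer j satisfies
-- m₀ μ < j ≤ n₀ ν.  Then p = n₀ N − j a ≥ 0 and q = j b − m₀ N ≥ 1 solve p b + q a = N,
-- which is p/μ + q/ν = 1.

open import Data.Empty using (⊥; ⊥-elim)
open import Data.Product using (_×_; _,_; proj₁; proj₂; ∃-syntax)
open import Data.Integer as ℤ using (ℤ; +_; 0ℤ; 1ℤ)
import Data.Integer.DivMod as ℤD
import Data.Integer.Properties as ℤP
open import Data.Integer.Solver using () renaming (module +-*-Solver to ℤ-Solver)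
open import Data.Nat as ℕ using (ℕ; z≤n; s≤s)
import Data.Nat.Properties as ℕP
open import Data.Nat.Coprimality using (Coprime; coprime-Bézout; recompute)
open import Data.Nat.GCD using (module Bézout)
open import Data.Rational
import Data.Rational.Properties as ℚP
open import Data.Rational.Solver using (module +-*-Solver)
import Data.Rational.Unnormalised as ℚᵘ
import Data.Rational.Unnormalised.Properties as ℚᵘP
open import Function.Bundles using (_⇔_; mk⇔)
open import Relation.Binary.PropositionalEquality
open import Relation.Nullary using (¬_; yes; no)
open import Defs

toℚᵘ-⟦⟧ : ∀ k → toℚᵘ ⟦ k ⟧ ℚᵘ.≃ ℚᵘ.mkℚᵘ k 0
toℚᵘ-⟦⟧ k = ℚP.toℚᵘ-fromℚᵘ (ℚᵘ.mkℚᵘ k 0)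

⟦⟧-via-ℚᵘ : ∀ {k q} → ℚᵘ.mkℚᵘ k 0 ℚᵘ.≃ toℚᵘ q → ⟦ k ⟧ ≡ q
⟦⟧-via-ℚᵘ {k} k≃q = ℚP.toℚᵘ-injective (ℚᵘP.≃-trans (toℚᵘ-⟦⟧ k) k≃q)

⟦⟧-+ : ∀ a b → ⟦ a ℤ.+ b ⟧ ≡ ⟦ a ⟧ + ⟦ b ⟧
⟦⟧-+ a b = ⟦⟧-via-ℚᵘ (begin-equality
  ℚᵘ.mkℚᵘ (a ℤ.+ b) 0                ≃⟨ ℚᵘ.*≡* (cong₂ (λ u v → (u ℤ.+ v) ℤ.* + 1)
                                           (sym (ℤP.*-identityʳ a)) (sym (ℤP.*-identityʳ b))) ⟩
  ℚᵘ.mkℚᵘ a 0 ℚᵘ.+ ℚᵘ.mkℚᵘ b 0       ≃⟨ ℚᵘP.+-cong (toℚᵘ-⟦⟧ a) (toℚᵘ-⟦⟧ b) ⟨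
  toℚᵘ ⟦ a ⟧ ℚᵘ.+ toℚᵘ ⟦ b ⟧          ≃⟨ ℚP.toℚᵘ-homo-+ ⟦ a ⟧ ⟦ b ⟧ ⟨
  toℚᵘ (⟦ a ⟧ + ⟦ b ⟧)               ∎)
  where open ℚᵘP.≤-Reasoning

⟦⟧-* : ∀ a b → ⟦ a ℤ.* b ⟧ ≡ ⟦ a ⟧ * ⟦ b ⟧
⟦⟧-* a b = ⟦⟧-via-ℚᵘ (begin-equality
  ℚᵘ.mkℚᵘ (a ℤ.* b) 0                ≃⟨ ℚᵘ.*≡* refl ⟩
  ℚᵘ.mkℚᵘ a 0 ℚᵘ.* ℚᵘ.mkℚᵘ b 0       ≃⟨ ℚᵘP.*-cong (toℚᵘ-⟦⟧ a) (toℚᵘ-⟦⟧ b) ⟨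
  toℚᵘ ⟦ a ⟧ ℚᵘ.* toℚᵘ ⟦ b ⟧          ≃⟨ ℚP.toℚᵘ-homo-* ⟦ a ⟧ ⟦ b ⟧ ⟨
  toℚᵘ (⟦ a ⟧ * ⟦ b ⟧)               ∎)
  where open ℚᵘP.≤-Reasoning

⟦⟧-suc : ∀ k → ⟦ ℤ.suc k ⟧ ≡ ⟦ k ⟧ + 1ℚ
⟦⟧-suc k = trans (⟦⟧-+ 1ℤ k) (ℚP.+-comm 1ℚ ⟦ k ⟧)

⟦⟧-mono-≤ : ∀ {a b} → a ℤ.≤ b → ⟦ a ⟧ ≤ ⟦ b ⟧
⟦⟧-mono-≤ {a} {b} a≤b = ℚP.toℚᵘ-cancel-≤
  (ℚᵘP.≤-respˡ-≃ (ℚᵘP.≃-sym (toℚᵘ-⟦⟧ a)) (ℚᵘP.≤-respʳ-≃ (ℚᵘP.≃-sym (toℚᵘ-⟦⟧ b))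
    (ℚᵘ.*≤* (ℤP.*-monoʳ-≤-nonNeg (+ 1) a≤b))))

⟦⟧-cancel-≤ : ∀ {a b} → ⟦ a ⟧ ≤ ⟦ b ⟧ → a ℤ.≤ b
⟦⟧-cancel-≤ {a} {b} ⟦a⟧≤⟦b⟧
  with ℚᵘP.≤-respˡ-≃ (toℚᵘ-⟦⟧ a) (ℚᵘP.≤-respʳ-≃ (toℚᵘ-⟦⟧ b) (ℚP.toℚᵘ-mono-≤ ⟦a⟧≤⟦b⟧))
... | ℚᵘ.*≤* a*1≤b*1 = subst₂ ℤ._≤_ (ℤP.*-identityʳ a) (ℤP.*-identityʳ b) a*1≤b*1

⟦⟧-mono-< : ∀ {a b} → a ℤ.< b → ⟦ a ⟧ < ⟦ b ⟧
⟦⟧-mono-< {a} {b} a<b = ℚP.toℚᵘ-cancel-<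
  (ℚᵘP.<-respˡ-≃ (ℚᵘP.≃-sym (toℚᵘ-⟦⟧ a)) (ℚᵘP.<-respʳ-≃ (ℚᵘP.≃-sym (toℚᵘ-⟦⟧ b))
    (ℚᵘ.*<* (ℤP.*-monoʳ-<-pos (+ 1) a<b))))

⟦⟧-cancel-< : ∀ {a b} → ⟦ a ⟧ < ⟦ b ⟧ → a ℤ.< b
⟦⟧-cancel-< {a} {b} ⟦a⟧<⟦b⟧
  with ℚᵘP.<-respˡ-≃ (toℚᵘ-⟦⟧ a) (ℚᵘP.<-respʳ-≃ (toℚᵘ-⟦⟧ b) (ℚP.toℚᵘ-mono-< ⟦a⟧<⟦b⟧))
... | ℚᵘ.*<* a*1<b*1 = subst₂ ℤ._<_ (ℤP.*-identityʳ a) (ℤP.*-identityʳ b) a*1<b*1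

⟦⟧-nonNeg : ∀ n → NonNegative ⟦ + n ⟧
⟦⟧-nonNeg n = nonNegative (⟦⟧-mono-≤ {0ℤ} {+ n} (ℤ.+≤+ z≤n))

⟦⟧-pos : ∀ {n} → 0 ℕ.< n → Positive ⟦ + n ⟧
⟦⟧-pos {n} n>0 = positive (⟦⟧-mono-< {0ℤ} {+ n} (ℤ.+<+ n>0))

no-integer-in-gap : ∀ k i → ⟦ k ⟧ < ⟦ i ⟧ → ⟦ i ⟧ < ⟦ k ⟧ + 1ℚ → ⊥
no-integer-in-gap k i k<i i<k+1 = ℤP.≤⇒≯ (ℤP.i<j⇒suc[i]≤j (⟦⟧-cancel-< {k} {i} k<i))
  (⟦⟧-cancel-< {i} {ℤ.suc k} (subst (⟦ i ⟧ <_) (sym (⟦⟧-suc k)) i<k+1))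

floor-≤ : ∀ q → ⟦ floor q ⟧ ≤ q
floor-≤ q@(mkℚ n d _) = ℚP.toℚᵘ-cancel-≤ (ℚᵘP.≤-respˡ-≃ (ℚᵘP.≃-sym (toℚᵘ-⟦⟧ (floor q)))
  (ℚᵘ.*≤* (subst₂ ℤ._≤_ (cong (ℤ._* + ℕ.suc d) (sym (ℤD.div-pos-is-/ℕ n (ℕ.suc d))))
                        (sym (ℤP.*-identityʳ n))
                        (ℤD.[n/ℕd]*d≤n n (ℕ.suc d)))))

<-floor+1 : ∀ q → q < ⟦ floor q ⟧ + 1ℚ
<-floor+1 q@(mkℚ n d _) = subst (q <_) (⟦⟧-suc (floor q)) (ℚP.toℚᵘ-cancel-<
  (ℚᵘP.<-respʳ-≃ (ℚᵘP.≃-sym (toℚᵘ-⟦⟧ (ℤ.suc (floor q))))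
    (ℚᵘ.*<* (subst₂ ℤ._<_ (sym (ℤP.*-identityʳ n))
                          (cong (λ f → ℤ.suc f ℤ.* + ℕ.suc d) (sym (ℤD.div-pos-is-/ℕ n (ℕ.suc d))))
                          (ℤD.n<s[n/ℕd]*d n (ℕ.suc d))))))

-- A diagonal point outside 𝒟 is integral: otherwise it lies in the open cell of its floor.
diagonal-outside-𝒟 : ∀ z → ¬ ((z , z) ∈𝒟) → ⟦ floor z ⟧ ≡ z
diagonal-outside-𝒟 z z∉𝒟 with ⟦ floor z ⟧ ℚP.<? z
... | yes ⌊z⌋<z = ⊥-elim (z∉𝒟 (floor z , ⌊z⌋<z , <-floor+1 z , ⌊z⌋<z , <-floor+1 z))
... | no  ⌊z⌋≮z = ℚP.≤-antisym (floor-≤ z) (ℚP.≮⇒≥ ⌊z⌋≮z)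

-- A point (x , y) above the diagonal and outside 𝒟' has an integer j with x < j ≤ y,
-- namely j = ⌊ y ⌋: if y is not integral and ⌊ y ⌋ ≤ x, the point lies in the cell of ⌊ y ⌋.
integer-between : ∀ x y → ¬ ((x , y) ∈𝒟') → x < y → ∃[ j ] (x < ⟦ j ⟧ × ⟦ j ⟧ ≤ y)
integer-between x y xy∉𝒟' x<y = floor y , x<⌊y⌋ , floor-≤ y
  where
  y<⌊y⌋+1 : y < ⟦ floor y ⟧ + 1ℚ
  y<⌊y⌋+1 = <-floor+1 y

  x<⌊y⌋ : x < ⟦ floor y ⟧
  x<⌊y⌋ with ⟦ floor y ⟧ ℚP.<? y | ⟦ floor y ⟧ ℚP.≤? x
  ... | no ⌊y⌋≮y | _ = subst (x <_) (ℚP.≤-antisym (ℚP.≮⇒≥ ⌊y⌋≮y) (floor-≤ y)) x<y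
  ... | yes ⌊y⌋<y | yes ⌊y⌋≤x = ⊥-elim (xy∉𝒟' (floor y , ⌊y⌋≤x ,
          ℚP.<⇒≤ (ℚP.<-trans x<y y<⌊y⌋+1) , ⌊y⌋<y , y<⌊y⌋+1 , ℚP.<⇒≢ x<y))
  ... | yes _ | no ⌊y⌋≰x = ℚP.≰⇒> ⌊y⌋≰x

mean-of-constant : ∀ A B → A + B ≡ 1ℚ → ∀ k → A * k + B * k ≡ k
mean-of-constant A B A+B≡1 k = begin
  A * k + B * k  ≡⟨ ℚP.*-distribʳ-+ k A B ⟨
  (A + B) * k    ≡⟨ cong (_* k) A+B≡1 ⟩
  1ℚ * k         ≡⟨ ℚP.*-identityˡ k ⟩
  k              ∎
  where open ≡-Reasoning

mean-above : ∀ {A B k x y} → 0ℚ ≤ A → 0ℚ < B → A + B ≡ 1ℚ →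
             k ≤ x → k < y → k < A * x + B * y
mean-above {A} {B} {k} {x} {y} A≥0 B>0 A+B≡1 k≤x k<y = begin-strict
  k              ≡⟨ mean-of-constant A B A+B≡1 k ⟨
  A * k + B * k  <⟨ ℚP.+-mono-≤-< (ℚP.*-monoˡ-≤-nonNeg A {{nonNegative A≥0}} k≤x)
                                  (ℚP.*-monoʳ-<-pos B {{positive B>0}} k<y) ⟩
  A * x + B * y  ∎
  where open ℚP.≤-Reasoning

mean-below : ∀ {A B l x y} → 0ℚ ≤ A → 0ℚ < B → A + B ≡ 1ℚ →
             x ≤ l → y < l → A * x + B * y < l
mean-below {A} {B} {l} {x} {y} A≥0 B>0 A+B≡1 x≤l y<l = begin-strict
  A * x + B * y  <⟨ ℚP.+-mono-≤-< (ℚP.*-monoˡ-≤-nonNeg A {{nonNegative A≥0}} x≤l)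
                                  (ℚP.*-monoʳ-<-pos B {{positive B>0}} y<l) ⟩
  A * l + B * l  ≡⟨ mean-of-constant A B A+B≡1 l ⟩
  l              ∎
  where open ℚP.≤-Reasoning

weight-on-lattice : ∀ p m μ .{{_ : NonZero μ}} → ⟦ p ⟧ * 1/ μ * (⟦ m ⟧ * μ) ≡ ⟦ p ℤ.* m ⟧
weight-on-lattice p m μ = begin
  ⟦ p ⟧ * 1/ μ * (⟦ m ⟧ * μ)    ≡⟨ solve 4 (λ P U M X → P :* U :* (M :* X) := P :* M :* (U :* X))
                                          refl ⟦ p ⟧ (1/ μ) ⟦ m ⟧ μ ⟩
  ⟦ p ⟧ * ⟦ m ⟧ * (1/ μ * μ)    ≡⟨ cong (⟦ p ⟧ * ⟦ m ⟧ *_) (ℚP.*-inverseˡ μ) ⟩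
  ⟦ p ⟧ * ⟦ m ⟧ * 1ℚ            ≡⟨ ℚP.*-identityʳ (⟦ p ⟧ * ⟦ m ⟧) ⟩
  ⟦ p ⟧ * ⟦ m ⟧                 ≡⟨ ⟦⟧-* p m ⟨
  ⟦ p ℤ.* m ⟧                   ∎
  where open ≡-Reasoning
        open +-*-Solver using (solve; _:*_; _:=_)

solution⇒disjoint : ∀ μ ν .{{_ : Positive μ}} .{{_ : Positive ν}} → M2' μ ν → M1' μ ν
solution⇒disjoint μ ν (p , q , 1≤q , A+B≡1) m n =
  (λ { (k , k<x , x<k+1 , k<y , y<k+1) → not-in-cell k (ℚP.<⇒≤ k<x) (ℚP.<⇒≤ x<k+1) k<y y<k+1 }) ,
  (λ { (k , k≤x , x≤k+1 , k<y , y<k+1 , _) → not-in-cell k k≤x x≤k+1 k<y y<k+1 })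
  where
  instance
    μ≢0 : NonZero μ
    μ≢0 = ℚP.pos⇒nonZero μ
    ν≢0 : NonZero ν
    ν≢0 = ℚP.pos⇒nonZero ν

  x y A B : ℚ
  x = ⟦ m ⟧ * μ
  y = ⟦ n ⟧ * ν
  A = ⟦ + p ⟧ * 1/ μ
  B = ⟦ + q ⟧ * 1/ ν

  A≥0 : 0ℚ ≤ A
  A≥0 = ℚP.nonNegative⁻¹ A {{ℚP.nonNeg*nonNeg⇒nonNeg ⟦ + p ⟧ {{⟦⟧-nonNeg p}}
          (1/ μ) {{ℚP.pos⇒nonNeg (1/ μ) {{ℚP.1/pos⇒pos μ}}}}}}

  B>0 : 0ℚ < B
  B>0 = ℚP.positive⁻¹ B {{ℚP.pos*pos⇒pos ⟦ + q ⟧ {{⟦⟧-pos 1≤q}}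
          (1/ ν) {{ℚP.1/pos⇒pos ν}}}}

  mean-integral : A * x + B * y ≡ ⟦ + p ℤ.* m ℤ.+ + q ℤ.* n ⟧
  mean-integral = trans (cong₂ _+_ (weight-on-lattice (+ p) m μ) (weight-on-lattice (+ q) n ν))
                        (sym (⟦⟧-+ (+ p ℤ.* m) (+ q ℤ.* n)))

  not-in-cell : ∀ k → ⟦ k ⟧ ≤ x → x ≤ ⟦ k ⟧ + 1ℚ → ⟦ k ⟧ < y → y < ⟦ k ⟧ + 1ℚ → ⊥
  not-in-cell k k≤x x≤k+1 k<y y<k+1 = no-integer-in-gap k (+ p ℤ.* m ℤ.+ + q ℤ.* n)
    (subst (⟦ k ⟧ <_) mean-integral (mean-above A≥0 B>0 A+B≡1 k≤x k<y))
    (subst (_< ⟦ k ⟧ + 1ℚ) mean-integral (mean-below A≥0 B>0 A+B≡1 x≤k+1 y<k+1))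

lowest-terms : ∀ r .{{_ : Positive r}} →
               ∃[ a ] ∃[ b ] (Coprime a b × 0 ℕ.< b × ⟦ + a ⟧ ≡ r * ⟦ + b ⟧)
lowest-terms r@(mkℚ (+ a) d a⊥d) = a , ℕ.suc d , recompute a⊥d , s≤s z≤n , ⟦⟧-via-ℚᵘ (begin-equality
  ℚᵘ.mkℚᵘ (+ a) 0                          ≃⟨ ℚᵘ.*≡* (trans (cong (λ e → + a ℤ.* + e) (ℕP.*-identityʳ (ℕ.suc d)))
                                                           (sym (ℤP.*-identityʳ _))) ⟩
  ℚᵘ.mkℚᵘ (+ a) d ℚᵘ.* ℚᵘ.mkℚᵘ (+ ℕ.suc d) 0  ≃⟨ ℚᵘP.*-cong (ℚᵘP.≃-refl {toℚᵘ r}) (toℚᵘ-⟦⟧ (+ ℕ.suc d)) ⟨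
  toℚᵘ r ℚᵘ.* toℚᵘ ⟦ + ℕ.suc d ⟧             ≃⟨ ℚP.toℚᵘ-homo-* r ⟦ + ℕ.suc d ⟧ ⟨
  toℚᵘ (r * ⟦ + ℕ.suc d ⟧)                   ∎)
  where open ℚᵘP.≤-Reasoning

commensurable : ∀ μ ν .{{_ : Positive μ}} .{{_ : Positive ν}} →
                ∃[ a ] ∃[ b ] (Coprime a b × 0 ℕ.< b × ⟦ + b ⟧ * μ ≡ ⟦ + a ⟧ * ν)
commensurable μ ν = cross-multiply (lowest-terms (μ * 1/ ν) {{ℚP.pos*pos⇒pos μ (1/ ν) {{ℚP.1/pos⇒pos ν}}}})
  where
  instance
    ν≢0 : NonZero ν
    ν≢0 = ℚP.pos⇒nonZero ν

  cross-multiply : ∃[ a ] ∃[ b ] (Coprime a b × 0 ℕ.< b × ⟦ + a ⟧ ≡ μ * 1/ ν * ⟦ + b ⟧) →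
                   ∃[ a ] ∃[ b ] (Coprime a b × 0 ℕ.< b × ⟦ + b ⟧ * μ ≡ ⟦ + a ⟧ * ν)
  cross-multiply (a , b , a⊥b , b>0 , a≡rb) = a , b , a⊥b , b>0 , (begin
    ⟦ + b ⟧ * μ                  ≡⟨ ℚP.*-identityʳ (⟦ + b ⟧ * μ) ⟨
    ⟦ + b ⟧ * μ * 1ℚ             ≡⟨ cong (⟦ + b ⟧ * μ *_) (ℚP.*-inverseˡ ν) ⟨
    ⟦ + b ⟧ * μ * (1/ ν * ν)     ≡⟨ solve 4 (λ B M U V → B :* M :* (U :* V) := M :* U :* B :* V)
                                            refl ⟦ + b ⟧ μ (1/ ν) ν ⟩
    μ * 1/ ν * ⟦ + b ⟧ * ν       ≡⟨ cong (_* ν) a≡rb ⟨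
    ⟦ + a ⟧ * ν                  ∎)
    where open ≡-Reasoning
          open +-*-Solver using (solve; _:*_; _:=_)

common-integer : ∀ μ ν .{{_ : Positive μ}} → M1' μ ν → ∀ a b → 0 ℕ.< b →
                 ⟦ + b ⟧ * μ ≡ ⟦ + a ⟧ * ν → ∃[ N ] (⟦ + b ⟧ * μ ≡ ⟦ N ⟧ × 0ℤ ℤ.< N)
common-integer μ ν disjoint a b b>0 bμ≡aν = floor bμ , sym N≡bμ , N>0
  where
  bμ : ℚ
  bμ = ⟦ + b ⟧ * μ

  N≡bμ : ⟦ floor bμ ⟧ ≡ bμ
  N≡bμ = diagonal-outside-𝒟 bμ (subst (λ w → ¬ ((bμ , w) ∈𝒟)) (sym bμ≡aν) (proj₁ (disjoint (+ b) (+ a))))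

  N>0 : 0ℤ ℤ.< floor bμ
  N>0 = ⟦⟧-cancel-< {0ℤ} {floor bμ} (subst (0ℚ <_) (sym N≡bμ)
          (ℚP.positive⁻¹ bμ {{ℚP.pos*pos⇒pos ⟦ + b ⟧ {{⟦⟧-pos b>0}} μ}}))

pos-bézout : ∀ s t u v → 1 ℕ.+ s ℕ.* t ≡ u ℕ.* v → + u ℤ.* + v ≡ 1ℤ ℤ.+ + s ℤ.* + t
pos-bézout s t u v e = begin
  + u ℤ.* + v            ≡⟨ ℤP.pos-* u v ⟨
  + (u ℕ.* v)            ≡⟨ cong +_ e ⟨
  + (1 ℕ.+ s ℕ.* t)      ≡⟨ cong (λ w → 1ℤ ℤ.+ w) (ℤP.pos-* s t) ⟩
  1ℤ ℤ.+ + s ℤ.* + t     ∎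
  where open ≡-Reasoning

bézout : ∀ {a b} → Coprime a b → ∃[ m₀ ] ∃[ n₀ ] (n₀ ℤ.* + b ≡ 1ℤ ℤ.+ m₀ ℤ.* + a)
bézout {a} {b} a⊥b with coprime-Bézout a⊥b
... | Bézout.-+ x y 1+xa≡yb = + x , + y , pos-bézout x a y b 1+xa≡yb
... | Bézout.+- x y 1+yb≡xa = ℤ.- + x , ℤ.- + y , (begin
  ℤ.- + y ℤ.* + b                     ≡⟨ solve 2 (λ Y B → :- Y :* B := con 1ℤ :+ :- (con 1ℤ :+ Y :* B))
                                                 refl (+ y) (+ b) ⟩
  1ℤ ℤ.+ ℤ.- (1ℤ ℤ.+ + y ℤ.* + b)     ≡⟨ cong (λ w → 1ℤ ℤ.+ ℤ.- w) (pos-bézout y b x a 1+yb≡xa) ⟨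
  1ℤ ℤ.+ ℤ.- (+ x ℤ.* + a)            ≡⟨ solve 2 (λ X A → con 1ℤ :+ :- (X :* A) := con 1ℤ :+ :- X :* A)
                                                 refl (+ x) (+ a) ⟩
  1ℤ ℤ.+ ℤ.- + x ℤ.* + a              ∎)
  where open ≡-Reasoning
        open ℤ-Solver using (solve; con; _:+_; _:*_; :-_; _:=_)

bézout-gap : ∀ a b N m₀ n₀ → n₀ ℤ.* b ≡ 1ℤ ℤ.+ m₀ ℤ.* a → 0ℤ ℤ.< N →
             a ℤ.* (m₀ ℤ.* N) ℤ.< b ℤ.* (n₀ ℤ.* N)
bézout-gap a b N m₀ n₀ n₀b≡1+m₀a N>0 =
  subst₂ ℤ._<_ (ℤP.+-identityˡ _) (sym b-side) (ℤP.+-monoˡ-< (a ℤ.* (m₀ ℤ.* N)) N>0)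
  where
  open ≡-Reasoning
  open ℤ-Solver using (solve; con; _:+_; _:*_; _:=_)

  b-side : b ℤ.* (n₀ ℤ.* N) ≡ N ℤ.+ a ℤ.* (m₀ ℤ.* N)
  b-side = begin
    b ℤ.* (n₀ ℤ.* N)             ≡⟨ solve 3 (λ B N₀ N → B :* (N₀ :* N) := N₀ :* B :* N) refl b n₀ N ⟩
    n₀ ℤ.* b ℤ.* N               ≡⟨ cong (ℤ._* N) n₀b≡1+m₀a ⟩
    (1ℤ ℤ.+ m₀ ℤ.* a) ℤ.* N      ≡⟨ solve 3 (λ A N M₀ → (con 1ℤ :+ M₀ :* A) :* N := N :+ A :* (M₀ :* N))
                                          refl a N m₀ ⟩
    N ℤ.+ a ℤ.* (m₀ ℤ.* N)       ∎

scale-lattice : ∀ s μ N m → ⟦ s ⟧ * μ ≡ ⟦ N ⟧ → ⟦ s ⟧ * (⟦ m ⟧ * μ) ≡ ⟦ m ℤ.* N ⟧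
scale-lattice s μ N m sμ≡N = begin
  ⟦ s ⟧ * (⟦ m ⟧ * μ)  ≡⟨ ℚP.*-assoc ⟦ s ⟧ ⟦ m ⟧ μ ⟨
  ⟦ s ⟧ * ⟦ m ⟧ * μ    ≡⟨ cong (_* μ) (ℚP.*-comm ⟦ s ⟧ ⟦ m ⟧) ⟩
  ⟦ m ⟧ * ⟦ s ⟧ * μ    ≡⟨ ℚP.*-assoc ⟦ m ⟧ ⟦ s ⟧ μ ⟩
  ⟦ m ⟧ * (⟦ s ⟧ * μ)  ≡⟨ cong (⟦ m ⟧ *_) sμ≡N ⟩
  ⟦ m ⟧ * ⟦ N ⟧        ≡⟨ ⟦⟧-* m N ⟨
  ⟦ m ℤ.* N ⟧          ∎
  where open ≡-Reasoning

module BézoutPoint (μ ν : ℚ) (a b : ℕ) (N m₀ n₀ : ℤ)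
                   (bμ≡N : ⟦ + b ⟧ * μ ≡ ⟦ N ⟧) (aν≡N : ⟦ + a ⟧ * ν ≡ ⟦ N ⟧)
                   (b>0 : 0 ℕ.< b) (N>0 : 0ℤ ℤ.< N)
                   (n₀b≡1+m₀a : n₀ ℤ.* + b ≡ 1ℤ ℤ.+ m₀ ℤ.* + a) where

  x y A B : ℚ
  x = ⟦ m₀ ⟧ * μ
  y = ⟦ n₀ ⟧ * ν
  A = ⟦ + a ⟧
  B = ⟦ + b ⟧

  -- Scaled by a b, the coordinates become the integers a m₀ N < b n₀ N = N + a m₀ N.
  above-diagonal : x < y
  above-diagonal = ℚP.*-cancelˡ-<-nonNeg (A * B) {{AB≥0}} (begin-strict
    A * B * x                      ≡⟨ ℚP.*-assoc A B x ⟩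
    A * (B * x)                    ≡⟨ cong (A *_) (scale-lattice (+ b) μ N m₀ bμ≡N) ⟩
    A * ⟦ m₀ ℤ.* N ⟧               ≡⟨ ⟦⟧-* (+ a) (m₀ ℤ.* N) ⟨
    ⟦ + a ℤ.* (m₀ ℤ.* N) ⟧          <⟨ ⟦⟧-mono-< {+ a ℤ.* (m₀ ℤ.* N)} {+ b ℤ.* (n₀ ℤ.* N)}
                                        (bézout-gap (+ a) (+ b) N m₀ n₀ n₀b≡1+m₀a N>0) ⟩
    ⟦ + b ℤ.* (n₀ ℤ.* N) ⟧          ≡⟨ ⟦⟧-* (+ b) (n₀ ℤ.* N) ⟩
    B * ⟦ n₀ ℤ.* N ⟧               ≡⟨ cong (B *_) (scale-lattice (+ a) ν N n₀ aν≡N) ⟨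
    B * (A * y)                    ≡⟨ solve 3 (λ A B y → B :* (A :* y) := A :* B :* y) refl A B y ⟩
    A * B * y                      ∎)
    where
    open ℚP.≤-Reasoning
    open +-*-Solver using (solve; _:*_; _:=_)

    AB≥0 : NonNegative (A * B)
    AB≥0 = ℚP.nonNeg*nonNeg⇒nonNeg A {{⟦⟧-nonNeg a}} B {{⟦⟧-nonNeg b}}

  gap : ¬ ((x , y) ∈𝒟') → ∃[ j ] (m₀ ℤ.* N ℤ.< j ℤ.* + b × j ℤ.* + a ℤ.≤ n₀ ℤ.* N)
  gap outside =
    let j , x<j , j≤y = integer-between x y outside above-diagonal
    in  j , lower j x<j , upper j j≤y
    where
    open ℚP.≤-Reasoning

    lower : ∀ j → x < ⟦ j ⟧ → m₀ ℤ.* N ℤ.< j ℤ.* + b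
    lower j x<j = ⟦⟧-cancel-< {m₀ ℤ.* N} {j ℤ.* + b} (begin-strict
      ⟦ m₀ ℤ.* N ⟧       ≡⟨ scale-lattice (+ b) μ N m₀ bμ≡N ⟨
      B * x              <⟨ ℚP.*-monoʳ-<-pos B {{⟦⟧-pos b>0}} x<j ⟩
      B * ⟦ j ⟧          ≡⟨ ℚP.*-comm B ⟦ j ⟧ ⟩
      ⟦ j ⟧ * B          ≡⟨ ⟦⟧-* j (+ b) ⟨
      ⟦ j ℤ.* + b ⟧      ∎)

    upper : ∀ j → ⟦ j ⟧ ≤ y → j ℤ.* + a ℤ.≤ n₀ ℤ.* N
    upper j j≤y = ⟦⟧-cancel-≤ {j ℤ.* + a} {n₀ ℤ.* N} (begin
      ⟦ j ℤ.* + a ⟧      ≡⟨ ⟦⟧-* j (+ a) ⟩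
      ⟦ j ⟧ * A          ≡⟨ ℚP.*-comm ⟦ j ⟧ A ⟩
      A * ⟦ j ⟧          ≤⟨ ℚP.*-monoˡ-≤-nonNeg A {{⟦⟧-nonNeg a}} j≤y ⟩
      A * y              ≡⟨ scale-lattice (+ a) ν N n₀ aν≡N ⟩
      ⟦ n₀ ℤ.* N ⟧       ∎)

solution-from-gap : ∀ a b N m₀ n₀ j → n₀ ℤ.* b ≡ 1ℤ ℤ.+ m₀ ℤ.* a →
                    m₀ ℤ.* N ℤ.< j ℤ.* b → j ℤ.* a ℤ.≤ n₀ ℤ.* N →
                    ∃[ p ] ∃[ q ] (1 ℕ.≤ q × + p ℤ.* b ℤ.+ + q ℤ.* a ≡ N)
solution-from-gap a b N m₀ n₀ j n₀b≡1+m₀a m₀N<jb ja≤n₀N = ℤ.∣ P ∣ , ℤ.∣ Q ∣ , 1≤∣Q∣ , identity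
  where
  P Q : ℤ
  P = n₀ ℤ.* N ℤ.- j ℤ.* a
  Q = j ℤ.* b ℤ.- m₀ ℤ.* N

  ∣P∣≡P : + ℤ.∣ P ∣ ≡ P
  ∣P∣≡P = ℤP.0≤i⇒+∣i∣≡i (ℤP.i≤j⇒0≤j-i ja≤n₀N)

  Q>0 : 0ℤ ℤ.< Q
  Q>0 = subst (ℤ._< Q) (ℤP.+-inverseʳ (m₀ ℤ.* N)) (ℤP.+-monoˡ-< (ℤ.- (m₀ ℤ.* N)) m₀N<jb)

  ∣Q∣≡Q : + ℤ.∣ Q ∣ ≡ Q
  ∣Q∣≡Q = ℤP.0≤i⇒+∣i∣≡i (ℤP.<⇒≤ Q>0)

  1≤∣Q∣ : 1 ℕ.≤ ℤ.∣ Q ∣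
  1≤∣Q∣ = ℤP.drop‿+<+ (subst (0ℤ ℤ.<_) (sym ∣Q∣≡Q) Q>0)

  identity : + ℤ.∣ P ∣ ℤ.* b ℤ.+ + ℤ.∣ Q ∣ ℤ.* a ≡ N
  identity = begin
    + ℤ.∣ P ∣ ℤ.* b ℤ.+ + ℤ.∣ Q ∣ ℤ.* a              ≡⟨ cong₂ (λ u v → u ℤ.* b ℤ.+ v ℤ.* a) ∣P∣≡P ∣Q∣≡Q ⟩
    P ℤ.* b ℤ.+ Q ℤ.* a                              ≡⟨ solve 6 (λ A B N M₀ N₀ J →
                                                          (N₀ :* N :- J :* A) :* B :+ (J :* B :- M₀ :* N) :* A
                                                          := N :* (N₀ :* B) :- N :* (M₀ :* A))
                                                          refl a b N m₀ n₀ j ⟩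
    N ℤ.* (n₀ ℤ.* b) ℤ.- N ℤ.* (m₀ ℤ.* a)            ≡⟨ cong (λ w → N ℤ.* w ℤ.- N ℤ.* (m₀ ℤ.* a)) n₀b≡1+m₀a ⟩
    N ℤ.* (1ℤ ℤ.+ m₀ ℤ.* a) ℤ.- N ℤ.* (m₀ ℤ.* a)     ≡⟨ solve 2 (λ N M → N :* (con 1ℤ :+ M) :- N :* M := N)
                                                          refl N (m₀ ℤ.* a) ⟩
    N                                                ∎
    where open ≡-Reasoning
          open ℤ-Solver using (solve; con; _:+_; _:*_; _:-_; _:=_)

*-cancelˡ-≡-pos : ∀ r .{{_ : Positive r}} {p q} → r * p ≡ r * q → p ≡ q
*-cancelˡ-≡-pos r rp≡rq = ℚP.≤-antisym (ℚP.*-cancelˡ-≤-pos r (ℚP.≤-reflexive rp≡rq))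
                                       (ℚP.*-cancelˡ-≤-pos r (ℚP.≤-reflexive (sym rp≡rq)))

divide-by-factor : ∀ s t μ .{{_ : NonZero μ}} → s * μ ≡ t → t * 1/ μ ≡ s
divide-by-factor s t μ sμ≡t = begin
  t * 1/ μ        ≡⟨ cong (_* 1/ μ) sμ≡t ⟨
  s * μ * 1/ μ    ≡⟨ ℚP.*-assoc s μ (1/ μ) ⟩
  s * (μ * 1/ μ)  ≡⟨ cong (s *_) (ℚP.*-inverseʳ μ) ⟩
  s * 1ℚ          ≡⟨ ℚP.*-identityʳ s ⟩
  s               ∎
  where open ≡-Reasoning

-- An integer solution gives (M2'): if b μ = N = a ν with N > 0 and p b + q a = N,
-- then N (p/μ + q/ν) = p b + q a = N, so p/μ + q/ν = 1.
solution-from-integers : ∀ μ ν .{{_ : Positive μ}} .{{_ : Positive ν}} a b N →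
                         ⟦ + b ⟧ * μ ≡ ⟦ N ⟧ → ⟦ + a ⟧ * ν ≡ ⟦ N ⟧ → 0ℤ ℤ.< N →
                         ∀ p q → 1 ℕ.≤ q → + p ℤ.* + b ℤ.+ + q ℤ.* + a ≡ N → M2' μ ν
solution-from-integers μ ν a b N bμ≡N aν≡N N>0 p q 1≤q pb+qa≡N =
  p , q , 1≤q , *-cancelˡ-≡-pos ⟦ N ⟧ {{positive (⟦⟧-mono-< {0ℤ} {N} N>0)}} scaled
  where
  instance
    μ≢0 : NonZero μ
    μ≢0 = ℚP.pos⇒nonZero μ
    ν≢0 : NonZero ν
    ν≢0 = ℚP.pos⇒nonZero ν

  P Q : ℚ
  P = ⟦ + p ⟧
  Q = ⟦ + q ⟧

  scaled : ⟦ N ⟧ * (P * 1/ μ + Q * 1/ ν) ≡ ⟦ N ⟧ * 1ℚ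
  scaled = begin
    ⟦ N ⟧ * (P * 1/ μ + Q * 1/ ν)              ≡⟨ solve 5 (λ N P Q U V → N :* (P :* U :+ Q :* V)
                                                      := P :* (N :* U) :+ Q :* (N :* V))
                                                      refl ⟦ N ⟧ P Q (1/ μ) (1/ ν) ⟩
    P * (⟦ N ⟧ * 1/ μ) + Q * (⟦ N ⟧ * 1/ ν)    ≡⟨ cong₂ (λ u v → P * u + Q * v)
                                                      (divide-by-factor ⟦ + b ⟧ ⟦ N ⟧ μ bμ≡N)
                                                      (divide-by-factor ⟦ + a ⟧ ⟦ N ⟧ ν aν≡N) ⟩
    P * ⟦ + b ⟧ + Q * ⟦ + a ⟧                  ≡⟨ cong₂ _+_ (⟦⟧-* (+ p) (+ b)) (⟦⟧-* (+ q) (+ a)) ⟨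
    ⟦ + p ℤ.* + b ⟧ + ⟦ + q ℤ.* + a ⟧          ≡⟨ ⟦⟧-+ (+ p ℤ.* + b) (+ q ℤ.* + a) ⟨
    ⟦ + p ℤ.* + b ℤ.+ + q ℤ.* + a ⟧            ≡⟨ cong ⟦_⟧ pb+qa≡N ⟩
    ⟦ N ⟧                                      ≡⟨ ℚP.*-identityʳ ⟦ N ⟧ ⟨
    ⟦ N ⟧ * 1ℚ                                 ∎
    where open ≡-Reasoning
          open +-*-Solver using (solve; _:+_; _:*_; _:=_)

disjoint⇒solution : ∀ μ ν .{{_ : Positive μ}} .{{_ : Positive ν}} → M1' μ ν → M2' μ ν
disjoint⇒solution μ ν disjoint =
  let a , b , a⊥b , b>0 , bμ≡aν = commensurable μ ν
      N , bμ≡N , N>0           = common-integer μ ν disjoint a b b>0 bμ≡aν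
      aν≡N : ⟦ + a ⟧ * ν ≡ ⟦ N ⟧
      aν≡N                     = trans (sym bμ≡aν) bμ≡N
      m₀ , n₀ , n₀b≡1+m₀a      = bézout a⊥b
      j , m₀N<jb , ja≤n₀N      = BézoutPoint.gap μ ν a b N m₀ n₀ bμ≡N aν≡N b>0 N>0 n₀b≡1+m₀a
                                   (proj₂ (disjoint m₀ n₀))
      p , q , 1≤q , pb+qa≡N    = solution-from-gap (+ a) (+ b) N m₀ n₀ j n₀b≡1+m₀a m₀N<jb ja≤n₀N
  in  solution-from-integers μ ν a b N bμ≡N aν≡N N>0 p q 1≤q pb+qa≡N

lemma4p10 : (μ ν : ℚ) → .{{_ : Positive μ}} → .{{_ : Positive ν}} → M1' μ ν ⇔ M2' μ ν
lemma4p10 μ ν = mk⇔ (disjoint⇒solution μ ν) (solution⇒disjoint μ ν)
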